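{- Let $k\geq 2$ be an integer and, for $n\geq 0$, let $a_{k,n}$ denote the number of weakly even-up words over $k$ of length $n$. Let $A_k(x)=\sum_{n\geq 0}a_{k,n}x^n$. Then \[A_k(x)=\begin{cases}\dfrac{1}{(1-x)^{\frac{k+2}{2}}+(1-x)^{\frac{k+2}{2}-1}+x-1}, & \text{if } k \text{ is even};\\[2ex] \dfrac{1}{(1-x)^{\frac{k+1}{2}}+(1-x)^{\frac{k+1}{2}-1}-1}, & \text{if } k \text{ is odd}.\end{cases}\]
   Context: For an integer $k\geq 2$, let $[k]=\{1,\ldots,k\}$. A word over $k$ of length $n$ is an element $w_1\cdots w_n\in[k]^n$ (for $n=0$ there is exactly one word, the empty word). A word $w_1\cdots w_n\in[k]^n$ is weakly even-up if for every $i\in[n-1]$, whenever $w_i$ is even, $w_{i+1}\geq w_i$. -}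

module Defs where

open import Data.Nat as ℕ using (ℕ; zero; suc; _∸_; _≤_; _≤?_)
open import Data.Nat.Divisibility using (_∣_; _∣?_)
open import Data.Nat.Combinatorics using (_C_)
open import Data.Integer as ℤ using (ℤ; +_; -_)
open import Data.Fin using (Fin; toℕ)
open import Data.Vec using (Vec; []; _∷_)
open import Data.List using (List; []; _∷_; [_]; map; concatMap; length; filter; upTo; foldr; allFin)
open import Data.Product using (_×_; _,_)
open import Data.Unit using (⊤; tt)
open import Relation.Nullary using (Dec; yes; no; ¬_)
open import Relation.Nullary.Decidable using (_×-dec_; _→-dec_)

-- A letter x : Fin k stands for the integer toℕ x + 1 ∈ [k] = {1,…,k}.
val : {k : ℕ} → Fin k → ℕ
val x = suc (toℕ x)

allWords : (k n : ℕ) → List (Vec (Fin k) n)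
allWords k zero    = [ [] ]
allWords k (suc n) = concatMap (λ x → map (x ∷_) (allWords k n)) (allFin k)

WeaklyEvenUp : {k n : ℕ} → Vec (Fin k) n → Set
WeaklyEvenUp []            = ⊤
WeaklyEvenUp (x ∷ [])      = ⊤
WeaklyEvenUp (x ∷ y ∷ w)   = ((2 ∣ val x) → val x ≤ val y) × WeaklyEvenUp (y ∷ w)

weaklyEvenUp? : {k n : ℕ} (w : Vec (Fin k) n) → Dec (WeaklyEvenUp w)
weaklyEvenUp? []          = yes tt
weaklyEvenUp? (x ∷ [])    = yes tt
weaklyEvenUp? (x ∷ y ∷ w) = ((2 ∣? val x) →-dec (val x ≤? val y)) ×-dec weaklyEvenUp? (y ∷ w)

a : ℕ → ℕ → ℕ
a k n = length (filter weaklyEvenUp? (allWords k n))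

Series : Set
Series = ℕ → ℤ

_⊛_ : Series → Series → Series
(f ⊛ g) n = foldr (λ i s → f i ℤ.* g (n ∸ i) ℤ.+ s) (+ 0) (upTo (suc n))

one : Series
one zero    = + 1
one (suc _) = + 0

X : Series
X 1 = + 1
X _ = + 0

_⊕_ : Series → Series → Series
(f ⊕ g) n = f n ℤ.+ g n

_⊖_ : Series → Series → Series
(f ⊖ g) n = f n ℤ.- g n

oneMinusXPow : ℕ → Series
oneMinusXPow m i = sign i ℤ.* (+ (m C i))
  where
  sign : ℕ → ℤ
  sign zero          = + 1
  sign (suc zero)    = - (+ 1)
  sign (suc (suc j)) = sign j

A : ℕ → Series
A k n = + (a k n)

denomEven : ℕ → Series
denomEven k = ((oneMinusXPow m ⊕ oneMinusXPow (m ∸ 1)) ⊕ X) ⊖ one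
  where m = (k ℕ.+ 2) ℕ./ 2

denomOdd : ℕ → Series
denomOdd k = (oneMinusXPow m ⊕ oneMinusXPow (m ∸ 1)) ⊖ one
  where m = (k ℕ.+ 1) ℕ./ 2

{-# OPTIONS --safe #-}
-- Let A≥t be the generating function of the weakly even-up words whose first letter, if
-- any, is at least t (the empty word included), so A_k = A≥1. An odd letter may be
-- followed by any letter and an even letter v only by letters ≥ v, so the words starting
-- with v are counted by x A_k for odd v and by x A≥v for even v. Splitting off the first
-- letter gives A≥2 = (1 - x) A_k and A≥(t+2) = (1 - x) A≥t - x A_k for even t < k, hence
-- A≥2m = A_k ((1 - x)^m + (1 - x)^(m-1) - 1) whenever 2m ≤ k + 1. For odd k = 2m - 1 no
-- letter exceeds k, so A≥2m = 1. For even k = 2m - 2 the words starting with k are the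
-- words k^n, so (1 - x) A≥k = 1, which is the even case after multiplying out.
module Submission where

open import Defs
open import Data.Bool using (Bool; true; false; if_then_else_)
open import Data.Fin using (Fin; toℕ; inject₁)
open import Data.Fin.Properties using (toℕ-inject₁; toℕ-fromℕ; toℕ≤pred[n])
open import Data.Integer as ℤ using (ℤ; +_; -_; _+_; _*_; _-_; 0ℤ; 1ℤ; -1ℤ)
import Data.Integer.Properties as ℤ
open import Data.Integer.Tactic.RingSolver using (solve-∀)
open import Data.List as List
  using (List; []; _∷_; map; filter; length; concatMap; allFin; tabulate; foldr; applyUpTo)
open import Data.List.Properties
  using (filter-++; length-++; filter-≐; filter-none; map-concatMap; map-cong; map-tabulate; tabulate-cong)
open import Data.List.Relation.Unary.All using (universal)
open import Data.Nat as ℕ using (ℕ; zero; suc; _∸_; _≤_; _<_; _≤?_; z≤n; s≤s)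
open import Data.Nat.Combinatorics using (_C_; nCk+nC[k+1]≡[n+1]C[k+1])
open import Data.Nat.DivMod using (m*n/n≡m)
open import Data.Nat.Divisibility using (_∣_; _∣?_; divides; ∣m∣n⇒∣m+n; ∣-refl)
open import Data.Nat.ListAction using () renaming (sum to sumList)
import Data.Nat.Properties as ℕ
open import Data.Product using (_×_; _,_; proj₁; proj₂; ∃-syntax)
open import Data.Vec using (Vec; _∷_)
open import Data.Vec.Functional using (Vector; init; last)
open import Function using (_∘_; id)
open import Relation.Nullary using (Dec; yes; no; does; ¬_; contradiction)
open import Relation.Nullary.Decidable using (_→-dec_; dec-true; dec-false)
open import Relation.Unary using (Pred; Decidable)
open import Relation.Binary.PropositionalEquality
open import Algebra.Properties.Semiring.Sum ℤ.+-*-semiring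
  using (sum; sum⁺-syntax; sum-cong-≗; sum-init-last; sum-replicate-zero; ∑-distrib-+; *-distribˡ-sum)

open ≡-Reasoning

-- Formal power series

shift : Series → Series
shift f zero    = 0ℤ
shift f (suc i) = f i

foldr-applyUpTo≡sum : ∀ m (g : ℕ → ℕ) (h : ℕ → ℤ) →
  foldr (λ i s → h i + s) 0ℤ (applyUpTo g m) ≡ sum (λ (i : Fin m) → h (g (toℕ i)))
foldr-applyUpTo≡sum zero    g h = refl
foldr-applyUpTo≡sum (suc m) g h = cong (λ s → h (g 0) + s) (foldr-applyUpTo≡sum m (g ∘ suc) h)

⊛≡∑ : ∀ f g n → (f ⊛ g) n ≡ ∑[ i ≤ n ] (f (toℕ i) * g (n ∸ toℕ i))
⊛≡∑ f g n = foldr-applyUpTo≡sum (suc n) id (λ i → f i * g (n ∸ i))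

⊛-congʳ : ∀ f {g h} → g ≗ h → ∀ n → (f ⊛ g) n ≡ (f ⊛ h) n
⊛-congʳ f {g} {h} g≗h n = begin
  (f ⊛ g) n                               ≡⟨ ⊛≡∑ f g n ⟩
  ∑[ i ≤ n ] (f (toℕ i) * g (n ∸ toℕ i))
    ≡⟨ sum-cong-≗ {suc n} (λ i → cong (f (toℕ i) *_) (g≗h (n ∸ toℕ i))) ⟩
  ∑[ i ≤ n ] (f (toℕ i) * h (n ∸ toℕ i))  ≡⟨ ⊛≡∑ f h n ⟨
  (f ⊛ h) n                               ∎

⊛-distribˡ-⊕ : ∀ f g h n → (f ⊛ (g ⊕ h)) n ≡ (f ⊛ g) n + (f ⊛ h) n
⊛-distribˡ-⊕ f g h n = begin
  (f ⊛ (g ⊕ h)) n                ≡⟨ ⊛≡∑ f (g ⊕ h) n ⟩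
  ∑[ i ≤ n ] (f (toℕ i) * (g ⊕ h) (n ∸ toℕ i))
    ≡⟨ sum-cong-≗ {suc n} (λ i → ℤ.*-distribˡ-+ (f (toℕ i)) (g (n ∸ toℕ i)) (h (n ∸ toℕ i))) ⟩
  sum (λ i → fg i + fh i)        ≡⟨ ∑-distrib-+ fg fh ⟩
  sum fg + sum fh                ≡⟨ cong₂ _+_ (⊛≡∑ f g n) (⊛≡∑ f h n) ⟨
  (f ⊛ g) n + (f ⊛ h) n          ∎
  where
  fg fh : Vector ℤ (suc n)
  fg i = f (toℕ i) * g (n ∸ toℕ i)
  fh i = f (toℕ i) * h (n ∸ toℕ i)

⊛-distribˡ-⊖ : ∀ f g h n → (f ⊛ (g ⊖ h)) n ≡ (f ⊛ g) n - (f ⊛ h) n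
⊛-distribˡ-⊖ f g h n = begin
  (f ⊛ (g ⊖ h)) n                  ≡⟨ ⊛≡∑ f (g ⊖ h) n ⟩
  ∑[ i ≤ n ] (f (toℕ i) * (g ⊖ h) (n ∸ toℕ i))
    ≡⟨ sum-cong-≗ {suc n} (λ i → distrib (f (toℕ i)) (g (n ∸ toℕ i)) (h (n ∸ toℕ i))) ⟩
  sum (λ i → fg i + -1ℤ * fh i)    ≡⟨ ∑-distrib-+ fg (λ i → -1ℤ * fh i) ⟩
  sum fg + sum (λ i → -1ℤ * fh i)  ≡⟨ cong (λ s → sum fg + s) (*-distribˡ-sum -1ℤ fh) ⟨
  sum fg + -1ℤ * sum fh            ≡⟨ cong (λ s → sum fg + s) (ℤ.-1*i≡-i (sum fh)) ⟩
  sum fg - sum fh                  ≡⟨ cong₂ _-_ (⊛≡∑ f g n) (⊛≡∑ f h n) ⟨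
  (f ⊛ g) n - (f ⊛ h) n            ∎
  where
  fg fh : Vector ℤ (suc n)
  fg i = f (toℕ i) * g (n ∸ toℕ i)
  fh i = f (toℕ i) * h (n ∸ toℕ i)
  distrib : ∀ a b c → a * (b - c) ≡ a * b + -1ℤ * (a * c)
  distrib = solve-∀

⊛-suc : ∀ f g n →
  (f ⊛ g) (suc n) ≡ ∑[ i ≤ n ] (f (toℕ i) * g (suc (n ∸ toℕ i))) + f (suc n) * g 0
⊛-suc f g n = begin
  (f ⊛ g) (suc n)          ≡⟨ ⊛≡∑ f g (suc n) ⟩
  sum t                    ≡⟨ sum-init-last t ⟩
  sum (init t) + last t    ≡⟨ cong₂ _+_ (sum-cong-≗ {suc n} initial) final ⟩
  ∑[ i ≤ n ] (f (toℕ i) * g (suc (n ∸ toℕ i))) + f (suc n) * g 0 ∎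
  where
  t : Vector ℤ (suc (suc n))
  t i = f (toℕ i) * g (suc n ∸ toℕ i)
  initial : ∀ i → t (inject₁ i) ≡ f (toℕ i) * g (suc (n ∸ toℕ i))
  initial i = trans (cong (λ j → f j * g (suc n ∸ j)) (toℕ-inject₁ i))
                    (cong (λ j → f (toℕ i) * g j) (ℕ.+-∸-assoc 1 (toℕ≤pred[n] i)))
  final : last t ≡ f (suc n) * g 0
  final = trans (cong (λ j → f j * g (suc n ∸ j)) (toℕ-fromℕ (suc n)))
                (cong (λ j → f (suc n) * g j) (ℕ.n∸n≡0 n))

⊛-identityʳ : ∀ f n → (f ⊛ one) n ≡ f n
⊛-identityʳ f zero    = trans (ℤ.+-identityʳ _) (ℤ.*-identityʳ (f 0))
⊛-identityʳ f (suc n) = begin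
  (f ⊛ one) (suc n)                             ≡⟨ ⊛-suc f one n ⟩
  ∑[ i ≤ n ] (f (toℕ i) * 0ℤ) + f (suc n) * 1ℤ
    ≡⟨ cong₂ _+_ (trans (sum-cong-≗ {suc n} (λ i → ℤ.*-zeroʳ (f (toℕ i)))) (sum-replicate-zero (suc n)))
                 (ℤ.*-identityʳ (f (suc n))) ⟩
  0ℤ + f (suc n)                                ≡⟨ ℤ.+-identityˡ (f (suc n)) ⟩
  f (suc n)                                     ∎

⊛-shiftʳ : ∀ f g n → (f ⊛ shift g) (suc n) ≡ (f ⊛ g) n
⊛-shiftʳ f g n = begin
  (f ⊛ shift g) (suc n)    ≡⟨ ⊛-suc f (shift g) n ⟩
  fg + f (suc n) * 0ℤ      ≡⟨ cong (λ s → fg + s) (ℤ.*-zeroʳ (f (suc n))) ⟩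
  fg + 0ℤ                  ≡⟨ ℤ.+-identityʳ fg ⟩
  fg                       ≡⟨ ⊛≡∑ f g n ⟨
  (f ⊛ g) n                ∎
  where
  fg : ℤ
  fg = ∑[ i ≤ n ] (f (toℕ i) * g (n ∸ toℕ i))

X≗shift-one : X ≗ shift one
X≗shift-one zero          = refl
X≗shift-one (suc zero)    = refl
X≗shift-one (suc (suc i)) = refl

⊛-Xʳ : ∀ f n → (f ⊛ X) (suc n) ≡ f n
⊛-Xʳ f n = trans (⊛-congʳ f X≗shift-one (suc n)) (trans (⊛-shiftʳ f one n) (⊛-identityʳ f n))

-- Powers of 1 - x

altSign : ℕ → ℤ
altSign zero          = 1ℤ
altSign (suc zero)    = -1ℤ
altSign (suc (suc i)) = altSign i

altSign-suc : ∀ i → altSign (suc i) ≡ - altSign i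
altSign-suc zero          = refl
altSign-suc (suc zero)    = refl
altSign-suc (suc (suc i)) = altSign-suc i

-- `oneMinusXPow` takes its sign from a function local to its `where` block, which cannot
-- be named here. With-abstracting the index `suc (suc i)` (and the comparison `suc i <ᵇ m`
-- that `_C_` unfolds to) out of the normalised goal separates the index from the argument
-- of that sign; the statement of the resulting induction is left for Agda to infer.
mutual
  LocalSign≡altSign : ℕ → ℕ → Bool → ℕ → Set
  LocalSign≡altSign = _

  oneMinusXPow≡altSign*C : ∀ m i → oneMinusXPow m i ≡ altSign i * + (m C i)
  oneMinusXPow≡altSign*C m zero          = refl
  oneMinusXPow≡altSign*C m (suc zero)    = refl
  oneMinusXPow≡altSign*C m (suc (suc i)) with suc i ℕ.<ᵇ m | suc (suc i)
  ... | b | p = localSign≡altSign m p b i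

  localSign≡altSign : ∀ m p b i → LocalSign≡altSign m p b i
  localSign≡altSign m p b zero          = refl
  localSign≡altSign m p b (suc zero)    = refl
  localSign≡altSign m p b (suc (suc i)) = localSign≡altSign m p b i

oneMinusXPow-zero : oneMinusXPow 0 ≗ one
oneMinusXPow-zero zero    = refl
oneMinusXPow-zero (suc i) = trans (oneMinusXPow≡altSign*C 0 (suc i)) (ℤ.*-zeroʳ (altSign (suc i)))

oneMinusXPow-suc : ∀ j → oneMinusXPow (suc j) ≗ oneMinusXPow j ⊖ shift (oneMinusXPow j)
oneMinusXPow-suc j zero    = refl
oneMinusXPow-suc j (suc i) = begin
  oneMinusXPow (suc j) (suc i)                         ≡⟨ oneMinusXPow≡altSign*C (suc j) (suc i) ⟩
  altSign (suc i) * + (suc j C suc i)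
    ≡⟨ cong₂ _*_ (altSign-suc i) (cong +_ (sym (nCk+nC[k+1]≡[n+1]C[k+1] j i))) ⟩
  - s * + (j C i ℕ.+ j C suc i)                        ≡⟨ cong (- s *_) (ℤ.pos-+ (j C i) (j C suc i)) ⟩
  - s * (+ (j C i) + + (j C suc i))                    ≡⟨ pascal s (+ (j C i)) (+ (j C suc i)) ⟩
  - s * + (j C suc i) - s * + (j C i)
    ≡⟨ cong (λ s′ → s′ * + (j C suc i) - s * + (j C i)) (altSign-suc i) ⟨
  altSign (suc i) * + (j C suc i) - s * + (j C i)
    ≡⟨ cong₂ _-_ (oneMinusXPow≡altSign*C j (suc i)) (oneMinusXPow≡altSign*C j i) ⟨
  oneMinusXPow j (suc i) - oneMinusXPow j i            ∎
  where
  s : ℤ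
  s = altSign i
  pascal : ∀ s a b → - s * (a + b) ≡ - s * b - s * a
  pascal = solve-∀

⊛-oneMinusXPow-zero : ∀ f n → (f ⊛ oneMinusXPow 0) n ≡ f n
⊛-oneMinusXPow-zero f n = trans (⊛-congʳ f oneMinusXPow-zero n) (⊛-identityʳ f n)

⊛-oneMinusXPow-suc : ∀ f j n →
  (f ⊛ oneMinusXPow (suc j)) (suc n) ≡ (f ⊛ oneMinusXPow j) (suc n) - (f ⊛ oneMinusXPow j) n
⊛-oneMinusXPow-suc f j n = begin
  (f ⊛ oneMinusXPow (suc j)) (suc n)                ≡⟨ ⊛-congʳ f (oneMinusXPow-suc j) (suc n) ⟩
  (f ⊛ (P ⊖ shift P)) (suc n)                       ≡⟨ ⊛-distribˡ-⊖ f P (shift P) (suc n) ⟩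
  (f ⊛ P) (suc n) - (f ⊛ shift P) (suc n)           ≡⟨ cong (λ s → (f ⊛ P) (suc n) - s) (⊛-shiftʳ f P n) ⟩
  (f ⊛ P) (suc n) - (f ⊛ P) n                       ∎
  where
  P : Series
  P = oneMinusXPow j

-- Definitionally, denomOdd k = oddDenominator ((k + 1) / 2) and
-- denomEven k = evenDenominator ((k + 2) / 2).
oddDenominator evenDenominator : ℕ → Series
oddDenominator  m = (oneMinusXPow m ⊕ oneMinusXPow (m ∸ 1)) ⊖ one
evenDenominator m = ((oneMinusXPow m ⊕ oneMinusXPow (m ∸ 1)) ⊕ X) ⊖ one

⊛-oddDenominator : ∀ f m n →
  (f ⊛ oddDenominator m) n ≡ (f ⊛ oneMinusXPow m) n + (f ⊛ oneMinusXPow (m ∸ 1)) n - f n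
⊛-oddDenominator f m n =
  trans (⊛-distribˡ-⊖ f (oneMinusXPow m ⊕ oneMinusXPow (m ∸ 1)) one n)
        (cong₂ _-_ (⊛-distribˡ-⊕ f (oneMinusXPow m) (oneMinusXPow (m ∸ 1)) n) (⊛-identityʳ f n))

⊛-evenDenominator : ∀ f m n → (f ⊛ evenDenominator m) (suc n) ≡ (f ⊛ oddDenominator m) (suc n) + f n
⊛-evenDenominator f m n = begin
  (f ⊛ ((P ⊕ X) ⊖ one)) (suc n)                 ≡⟨ ⊛-distribˡ-⊖ f (P ⊕ X) one (suc n) ⟩
  (f ⊛ (P ⊕ X)) (suc n) - f₁                    ≡⟨ cong (_- f₁) (⊛-distribˡ-⊕ f P X (suc n)) ⟩
  (f ⊛ P) (suc n) + (f ⊛ X) (suc n) - f₁        ≡⟨ cong (λ s → (f ⊛ P) (suc n) + s - f₁) (⊛-Xʳ f n) ⟩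
  (f ⊛ P) (suc n) + f n - f₁                    ≡⟨ swap ((f ⊛ P) (suc n)) (f n) f₁ ⟩
  (f ⊛ P) (suc n) - f₁ + f n                    ≡⟨ cong (_+ f n) (⊛-distribˡ-⊖ f P one (suc n)) ⟨
  (f ⊛ (P ⊖ one)) (suc n) + f n                 ∎
  where
  P : Series
  P = oneMinusXPow m ⊕ oneMinusXPow (m ∸ 1)
  f₁ : ℤ
  f₁ = (f ⊛ one) (suc n)
  swap : ∀ a b c → a + b - c ≡ a - c + b
  swap = solve-∀

⊛-oddDenominator-one : ∀ f n → (f ⊛ oddDenominator 1) (suc n) ≡ f (suc n) - f n
⊛-oddDenominator-one f n = begin
  (f ⊛ oddDenominator 1) (suc n)                  ≡⟨ ⊛-oddDenominator f 1 (suc n) ⟩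
  (f ⊛ oneMinusXPow 1) (suc n) + h₀ (suc n) - f (suc n)
    ≡⟨ cong (λ s → s + h₀ (suc n) - f (suc n)) (⊛-oneMinusXPow-suc f 0 n) ⟩
  h₀ (suc n) - h₀ n + h₀ (suc n) - f (suc n)
    ≡⟨ cong₂ (λ a b → a - b + a - f (suc n)) (⊛-oneMinusXPow-zero f (suc n)) (⊛-oneMinusXPow-zero f n) ⟩
  f (suc n) - f n + f (suc n) - f (suc n)         ≡⟨ cancel (f (suc n)) (f n) ⟩
  f (suc n) - f n                                 ∎
  where
  h₀ : Series
  h₀ = f ⊛ oneMinusXPow 0
  cancel : ∀ a b → a - b + a - a ≡ a - b
  cancel = solve-∀

⊛-oddDenominator-suc : ∀ f m n →
  (f ⊛ oddDenominator (suc (suc m))) (suc n) ≡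
  (f ⊛ oddDenominator (suc m)) (suc n) - ((f ⊛ oddDenominator (suc m)) n + f n)
⊛-oddDenominator-suc f m n = begin
  (f ⊛ oddDenominator (suc (suc m))) (suc n)      ≡⟨ ⊛-oddDenominator f (suc (suc m)) (suc n) ⟩
  h₂ (suc n) + h₁ (suc n) - f (suc n)
    ≡⟨ cong₂ (λ a b → a + b - f (suc n)) (⊛-oneMinusXPow-suc f (suc m) n) (⊛-oneMinusXPow-suc f m n) ⟩
  (h₁ (suc n) - h₁ n) + (h₀ (suc n) - h₀ n) - f (suc n)
    ≡⟨ regroup (h₁ (suc n)) (h₁ n) (h₀ (suc n)) (h₀ n) (f (suc n)) (f n) ⟩
  (h₁ (suc n) + h₀ (suc n) - f (suc n)) - ((h₁ n + h₀ n - f n) + f n)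
    ≡⟨ cong₂ (λ a b → a - (b + f n)) (⊛-oddDenominator f (suc m) (suc n)) (⊛-oddDenominator f (suc m) n) ⟨
  (f ⊛ oddDenominator (suc m)) (suc n) - ((f ⊛ oddDenominator (suc m)) n + f n) ∎
  where
  h₂ h₁ h₀ : Series
  h₂ = f ⊛ oneMinusXPow (suc (suc m))
  h₁ = f ⊛ oneMinusXPow (suc m)
  h₀ = f ⊛ oneMinusXPow m
  regroup : ∀ a₁ b₁ a₀ b₀ c d → (a₁ - b₁) + (a₀ - b₀) - c ≡ (a₁ + a₀ - c) - ((b₁ + b₀ - d) + d)
  regroup = solve-∀

-- Counting words

sumFrom : ℕ → ℕ → (ℕ → ℕ) → ℕ
sumFrom t zero    h = 0
sumFrom t (suc c) h = h t ℕ.+ sumFrom (suc t) c h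

sumFrom-cong : ∀ t c {g h : ℕ → ℕ} → (∀ u → t ≤ u → u < t ℕ.+ c → g u ≡ h u) →
  sumFrom t c g ≡ sumFrom t c h
sumFrom-cong t zero    g≡h = refl
sumFrom-cong t (suc c) g≡h =
  cong₂ ℕ._+_ (g≡h t ℕ.≤-refl (ℕ.m<m+n t (s≤s z≤n)))
              (sumFrom-cong (suc t) c λ u t<u u<t+c →
                 g≡h u (ℕ.<⇒≤ t<u) (subst (u <_) (sym (ℕ.+-suc t c)) u<t+c))

sumFrom-zero : ∀ t c → sumFrom t c (λ _ → 0) ≡ 0
sumFrom-zero t zero    = refl
sumFrom-zero t (suc c) = sumFrom-zero (suc t) c

sumFrom-+ : ∀ t c d h → sumFrom t (c ℕ.+ d) h ≡ sumFrom t c h ℕ.+ sumFrom (t ℕ.+ c) d h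
sumFrom-+ t zero    d h = cong (λ s → sumFrom s d h) (sym (ℕ.+-identityʳ t))
sumFrom-+ t (suc c) d h = begin
  h t ℕ.+ sumFrom (suc t) (c ℕ.+ d) h                          ≡⟨ cong (h t ℕ.+_) (sumFrom-+ (suc t) c d h) ⟩
  h t ℕ.+ (sumFrom (suc t) c h ℕ.+ sumFrom (suc t ℕ.+ c) d h)  ≡⟨ ℕ.+-assoc (h t) _ _ ⟨
  h t ℕ.+ sumFrom (suc t) c h ℕ.+ sumFrom (suc t ℕ.+ c) d h
    ≡⟨ cong (λ s → h t ℕ.+ sumFrom (suc t) c h ℕ.+ sumFrom s d h) (ℕ.+-suc t c) ⟨
  h t ℕ.+ sumFrom (suc t) c h ℕ.+ sumFrom (t ℕ.+ suc c) d h    ∎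

sum-tabulate≡sumFrom : ∀ t m (h : ℕ → ℕ) →
  sumList (tabulate {n = m} (λ i → h (t ℕ.+ toℕ i))) ≡ sumFrom t m h
sum-tabulate≡sumFrom t zero    h = refl
sum-tabulate≡sumFrom t (suc m) h = cong₂ ℕ._+_ (cong h (ℕ.+-identityʳ t)) (begin
  sumList (tabulate {n = m} (λ i → h (t ℕ.+ suc (toℕ i))))
    ≡⟨ cong sumList (tabulate-cong {n = m} (λ i → cong h (ℕ.+-suc t (toℕ i)))) ⟩
  sumList (tabulate {n = m} (λ i → h (suc t ℕ.+ toℕ i)))  ≡⟨ sum-tabulate≡sumFrom (suc t) m h ⟩
  sumFrom (suc t) m h                                     ∎)

count : ∀ {a p} {A : Set a} {P : Pred A p} → Decidable P → List A → ℕ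
count P? = length ∘ filter P?

module _ {a p} {A : Set a} {P : Pred A p} (P? : Decidable P) where

  count-map : ∀ {b} {B : Set b} (f : B → A) xs → count P? (map f xs) ≡ count (P? ∘ f) xs
  count-map f []       = refl
  count-map f (x ∷ xs) with does (P? (f x))
  ... | true  = cong suc (count-map f xs)
  ... | false = count-map f xs

  count-concatMap : ∀ {b} {B : Set b} (φ : B → List A) xs →
    count P? (concatMap φ xs) ≡ sumList (map (count P? ∘ φ) xs)
  count-concatMap φ []       = refl
  count-concatMap φ (x ∷ xs) = begin
    length (filter P? (φ x List.++ concatMap φ xs))
      ≡⟨ cong length (filter-++ P? (φ x) (concatMap φ xs)) ⟩
    length (filter P? (φ x) List.++ filter P? (concatMap φ xs))
      ≡⟨ length-++ (filter P? (φ x)) ⟩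
    count P? (φ x) ℕ.+ count P? (concatMap φ xs)
      ≡⟨ cong (count P? (φ x) ℕ.+_) (count-concatMap φ xs) ⟩
    count P? (φ x) ℕ.+ sumList (map (count P? ∘ φ) xs)
      ∎

  count-concatMap-allFin : ∀ {k} (φ : Fin k → List A) (h : ℕ → ℕ) →
    (∀ x → count P? (φ x) ≡ h (val x)) → count P? (concatMap φ (allFin k)) ≡ sumFrom 1 k h
  count-concatMap-allFin {k} φ h count≡h = begin
    count P? (concatMap φ (allFin k))          ≡⟨ count-concatMap φ (allFin k) ⟩
    sumList (map (count P? ∘ φ) (allFin k))    ≡⟨ cong sumList (map-cong count≡h (allFin k)) ⟩
    sumList (map (h ∘ val) (allFin k))         ≡⟨ cong sumList (map-tabulate {n = k} id (h ∘ val)) ⟩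
    sumList (tabulate {n = k} (h ∘ val))       ≡⟨ sum-tabulate≡sumFrom 1 k h ⟩
    sumFrom 1 k h                              ∎

if-does : ∀ {p} {P : Set p} (P? : Dec P) {m n : ℕ} →
  (P → m ≡ n) → (¬ P → m ≡ 0) → m ≡ (if does P? then n else 0)
if-does (yes p) m≡n m≡0 = m≡n p
if-does (no ¬p) m≡n m≡0 = m≡0 ¬p

evenUp? : (v u : ℕ) → Dec (2 ∣ v → v ≤ u)
evenUp? v u = (2 ∣? v) →-dec (v ≤? u)

2∤1+q*2 : ∀ q → ¬ 2 ∣ suc (q ℕ.* 2)
2∤1+q*2 q (divides p eq) = ℕ.even≢odd p q (begin
  2 ℕ.* p          ≡⟨ ℕ.*-comm 2 p ⟩
  p ℕ.* 2          ≡⟨ eq ⟨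
  suc (q ℕ.* 2)    ≡⟨ cong suc (ℕ.*-comm q 2) ⟩
  suc (2 ℕ.* q)    ∎)

m≡n+o⇒o≡m-n : ∀ {m n o : ℕ} → m ≡ n ℕ.+ o → + o ≡ + m - + n
m≡n+o⇒o≡m-n {n = n} {o} refl = begin
  + o                   ≡⟨ cancel (+ n) (+ o) ⟩
  + n + + o - + n       ≡⟨ cong (_- + n) (ℤ.pos-+ n o) ⟨
  + (n ℕ.+ o) - + n     ∎
  where
  cancel : ∀ a b → b ≡ a + b - a
  cancel = solve-∀

module Counting (k : ℕ) where

  -- #startingWith v n counts the weakly even-up words v w with w of length n, and
  -- #headAtLeast t n those of length n whose first letter (if any) is at least t.
  #startingWith : ℕ → ℕ → ℕ
  #startingWith v zero    = 1
  #startingWith v (suc n) = sumFrom 1 k (λ u → if does (evenUp? v u) then #startingWith u n else 0)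

  #headAtLeast : ℕ → ℕ → ℕ
  #headAtLeast t zero    = 1
  #headAtLeast t (suc n) = sumFrom t (suc k ∸ t) (λ u → #startingWith u n)

  module _ {n} (x y : Fin k) (ws : List (Vec (Fin k) n)) where

    count-∷∷ : count weaklyEvenUp? (map (x ∷_) (map (y ∷_) ws)) ≡ count (λ w → weaklyEvenUp? (x ∷ y ∷ w)) ws
    count-∷∷ = trans (count-map weaklyEvenUp? (x ∷_) (map (y ∷_) ws))
                     (count-map (λ v → weaklyEvenUp? (x ∷ v)) (y ∷_) ws)

    count-accept : (2 ∣ val x → val x ≤ val y) →
      count weaklyEvenUp? (map (x ∷_) (map (y ∷_) ws)) ≡ count weaklyEvenUp? (map (y ∷_) ws)
    count-accept x↝y = begin
      count weaklyEvenUp? (map (x ∷_) (map (y ∷_) ws))  ≡⟨ count-∷∷ ⟩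
      count (λ w → weaklyEvenUp? (x ∷ y ∷ w)) ws        ≡⟨ cong length (filter-≐ _ _ (proj₂ , (x↝y ,_)) ws) ⟩
      count (λ w → weaklyEvenUp? (y ∷ w)) ws            ≡⟨ count-map weaklyEvenUp? (y ∷_) ws ⟨
      count weaklyEvenUp? (map (y ∷_) ws)               ∎

    count-reject : ¬ (2 ∣ val x → val x ≤ val y) → count weaklyEvenUp? (map (x ∷_) (map (y ∷_) ws)) ≡ 0
    count-reject x↝̸y = trans count-∷∷ (cong length (filter-none _ (universal (λ _ → x↝̸y ∘ proj₁) ws)))

  count-startingWith : ∀ n (x : Fin k) →
    count weaklyEvenUp? (map (x ∷_) (allWords k n)) ≡ #startingWith (val x) n
  count-startingWith zero    x = refl
  count-startingWith (suc n) x = begin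
    count weaklyEvenUp? (map (x ∷_) (concatMap (λ y → map (y ∷_) W) (allFin k)))
      ≡⟨ cong (count weaklyEvenUp?) (map-concatMap (x ∷_) (λ y → map (y ∷_) W) (allFin k)) ⟩
    count weaklyEvenUp? (concatMap (λ y → map (x ∷_) (map (y ∷_) W)) (allFin k))
      ≡⟨ count-concatMap-allFin weaklyEvenUp? _ _ (λ y → if-does (evenUp? (val x) (val y))
           (λ x↝y → trans (count-accept x y W x↝y) (count-startingWith n y)) (count-reject x y W)) ⟩
    #startingWith (val x) (suc n)
      ∎
    where
    W : List (Vec (Fin k) n)
    W = allWords k n

  a≡#headAtLeast1 : ∀ n → a k n ≡ #headAtLeast 1 n
  a≡#headAtLeast1 zero    = refl
  a≡#headAtLeast1 (suc n) =
    count-concatMap-allFin weaklyEvenUp? (λ x → map (x ∷_) (allWords k n)) _ (count-startingWith n)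

  #startingWith-odd : ∀ {v} → ¬ 2 ∣ v → ∀ n → #startingWith v n ≡ #headAtLeast 1 n
  #startingWith-odd     ∤v zero    = refl
  #startingWith-odd {v} ∤v (suc n) = sumFrom-cong 1 k λ u _ _ →
    cong (λ b → if b then #startingWith u n else 0) (dec-true (evenUp? v u) (λ ∣v → contradiction ∣v ∤v))

  #startingWith-even : ∀ {v} → 2 ∣ v → 1 ≤ v → v ≤ k → ∀ n → #startingWith v n ≡ #headAtLeast v n
  #startingWith-even ∣v 1≤v v≤k zero = refl
  #startingWith-even {suc v} ∣v _ v<k (suc n) = begin
    sumFrom 1 k H                                  ≡⟨ cong (λ c → sumFrom 1 c H) (ℕ.m+[n∸m]≡n (ℕ.<⇒≤ v<k)) ⟨
    sumFrom 1 (v ℕ.+ (k ∸ v)) H                    ≡⟨ sumFrom-+ 1 v (k ∸ v) H ⟩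
    sumFrom 1 v H ℕ.+ sumFrom (suc v) (k ∸ v) H    ≡⟨ cong₂ ℕ._+_ below above ⟩
    0 ℕ.+ #headAtLeast (suc v) (suc n)             ∎
    where
    H : ℕ → ℕ
    H u = if does (evenUp? (suc v) u) then #startingWith u n else 0
    below : sumFrom 1 v H ≡ 0
    below = trans (sumFrom-cong 1 v λ u _ u≤v →
                     cong (λ b → if b then #startingWith u n else 0)
                          (dec-false (evenUp? (suc v) u) (λ v≤u → ℕ.<⇒≱ u≤v (v≤u ∣v))))
                  (sumFrom-zero 1 v)
    above : sumFrom (suc v) (k ∸ v) H ≡ #headAtLeast (suc v) (suc n)
    above = sumFrom-cong (suc v) (k ∸ v) λ u v≤u _ →
              cong (λ b → if b then #startingWith u n else 0) (dec-true (evenUp? (suc v) u) (λ _ → v≤u))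

  #headAtLeast-suc : ∀ {t} → t ≤ k → ∀ n →
    #headAtLeast t (suc n) ≡ #startingWith t n ℕ.+ #headAtLeast (suc t) (suc n)
  #headAtLeast-suc {t} t≤k n = cong (λ c → sumFrom t c (λ u → #startingWith u n)) (ℕ.+-∸-assoc 1 t≤k)

  #headAtLeast-beyond : ∀ {t} → k < t → ∀ n → #headAtLeast t (suc n) ≡ 0
  #headAtLeast-beyond {t} k<t n = cong (λ c → sumFrom t c (λ u → #startingWith u n)) (ℕ.m≤n⇒m∸n≡0 k<t)

  A≥ : ℕ → Series
  A≥ t n = + #headAtLeast t n

  A≥-two : 1 ≤ k → ∀ n → A≥ 2 (suc n) ≡ A k (suc n) - A k n
  A≥-two 1≤k n = m≡n+o⇒o≡m-n (begin
    a k (suc n)                                   ≡⟨ a≡#headAtLeast1 (suc n) ⟩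
    #headAtLeast 1 (suc n)                        ≡⟨ #headAtLeast-suc 1≤k n ⟩
    #startingWith 1 n ℕ.+ #headAtLeast 2 (suc n)
      ≡⟨ cong (ℕ._+ #headAtLeast 2 (suc n)) (trans (#startingWith-odd (2∤1+q*2 0) n) (sym (a≡#headAtLeast1 n))) ⟩
    a k n ℕ.+ #headAtLeast 2 (suc n)              ∎)

  A≥-step : ∀ j → suc (suc j ℕ.* 2) ≤ k → ∀ n →
    A≥ (suc (suc j) ℕ.* 2) (suc n) ≡ A≥ (suc j ℕ.* 2) (suc n) - (A≥ (suc j ℕ.* 2) n + A k n)
  A≥-step j t<k n = trans (m≡n+o⇒o≡m-n (begin
    #headAtLeast t (suc n)                                 ≡⟨ #headAtLeast-suc (ℕ.<⇒≤ t<k) n ⟩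
    #startingWith t n ℕ.+ #headAtLeast (suc t) (suc n)
      ≡⟨ cong₂ ℕ._+_ (#startingWith-even (divides (suc j) refl) (s≤s z≤n) (ℕ.<⇒≤ t<k) n)
                     (#headAtLeast-suc t<k n) ⟩
    #headAtLeast t n ℕ.+ (#startingWith (suc t) n ℕ.+ rest)
      ≡⟨ cong (λ s → #headAtLeast t n ℕ.+ (s ℕ.+ rest))
              (trans (#startingWith-odd (2∤1+q*2 (suc j)) n) (sym (a≡#headAtLeast1 n))) ⟩
    #headAtLeast t n ℕ.+ (a k n ℕ.+ rest)                  ≡⟨ ℕ.+-assoc (#headAtLeast t n) (a k n) rest ⟨
    #headAtLeast t n ℕ.+ a k n ℕ.+ rest                    ∎))
    (cong (λ s → A≥ t (suc n) - s) (ℤ.pos-+ (#headAtLeast t n) (a k n)))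
    where
    t rest : ℕ
    t    = suc j ℕ.* 2
    rest = #headAtLeast (2 ℕ.+ t) (suc n)

  A≥-top : 2 ∣ k → 1 ≤ k → ∀ n → A≥ k (suc n) ≡ A≥ k n
  A≥-top ∣k 1≤k n = cong +_ (begin
    #headAtLeast k (suc n)                              ≡⟨ #headAtLeast-suc ℕ.≤-refl n ⟩
    #startingWith k n ℕ.+ #headAtLeast (suc k) (suc n)
      ≡⟨ cong₂ ℕ._+_ (#startingWith-even ∣k 1≤k ℕ.≤-refl n) (#headAtLeast-beyond ℕ.≤-refl n) ⟩
    #headAtLeast k n ℕ.+ 0                              ≡⟨ ℕ.+-identityʳ _ ⟩
    #headAtLeast k n                                    ∎)

  A≥-beyond : ∀ {t} → k < t → ∀ n → A≥ t (suc n) ≡ 0ℤ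
  A≥-beyond k<t n = cong +_ (#headAtLeast-beyond k<t n)

  A≥≡A⊛oddDenominator : ∀ j → suc (j ℕ.* 2) ≤ k → ∀ n →
    A≥ (suc j ℕ.* 2) n ≡ (A k ⊛ oddDenominator (suc j)) n
  A≥≡A⊛oddDenominator j       _   zero    = refl
  A≥≡A⊛oddDenominator zero    1≤k (suc n) = trans (A≥-two 1≤k n) (sym (⊛-oddDenominator-one (A k) n))
  A≥≡A⊛oddDenominator (suc j) t<k (suc n) = begin
    A≥ (suc (suc j) ℕ.* 2) (suc n)                  ≡⟨ A≥-step j t<k n ⟩
    A≥ (suc j ℕ.* 2) (suc n) - (A≥ (suc j ℕ.* 2) n + A k n)
                                                    ≡⟨ cong₂ (λ a b → a - (b + A k n)) (IH (suc n)) (IH n) ⟩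
    D (suc n) - (D n + A k n)                       ≡⟨ ⊛-oddDenominator-suc (A k) j n ⟨
    (A k ⊛ oddDenominator (suc (suc j))) (suc n)    ∎
    where
    D : Series
    D = A k ⊛ oddDenominator (suc j)
    IH : ∀ n → A≥ (suc j ℕ.* 2) n ≡ D n
    IH = A≥≡A⊛oddDenominator j (ℕ.m+n≤o⇒n≤o 2 t<k)

A⊛evenDenominator≡one : ∀ j n → (A (suc j ℕ.* 2) ⊛ evenDenominator (suc (suc j))) n ≡ one n
A⊛evenDenominator≡one j zero    = refl
A⊛evenDenominator≡one j (suc n) = begin
  (A k ⊛ evenDenominator (suc (suc j))) (suc n)         ≡⟨ ⊛-evenDenominator (A k) (suc (suc j)) n ⟩
  (A k ⊛ oddDenominator (suc (suc j))) (suc n) + A k n  ≡⟨ cong (_+ A k n) (⊛-oddDenominator-suc (A k) j n) ⟩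
  D (suc n) - (D n + A k n) + A k n                     ≡⟨ cancel (D (suc n)) (D n) (A k n) ⟩
  D (suc n) - D n                                       ≡⟨ cong₂ _-_ (claim (suc n)) (claim n) ⟨
  A≥ k (suc n) - A≥ k n
    ≡⟨ cong (_- A≥ k n) (A≥-top (divides (suc j) refl) (s≤s z≤n) n) ⟩
  A≥ k n - A≥ k n                                       ≡⟨ ℤ.+-inverseʳ (A≥ k n) ⟩
  0ℤ                                                    ∎
  where
  k : ℕ
  k = suc j ℕ.* 2
  open Counting k
  D : Series
  D = A k ⊛ oddDenominator (suc j)
  claim : ∀ n → A≥ k n ≡ D n
  claim = A≥≡A⊛oddDenominator j (ℕ.n≤1+n _)
  cancel : ∀ a b c → a - (b + c) + c ≡ a - b
  cancel = solve-∀

A⊛oddDenominator≡one : ∀ j n → (A (suc (suc j ℕ.* 2)) ⊛ oddDenominator (suc (suc j))) n ≡ one n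
A⊛oddDenominator≡one j zero    = refl
A⊛oddDenominator≡one j (suc n) =
  trans (sym (A≥≡A⊛oddDenominator (suc j) ℕ.≤-refl (suc n))) (A≥-beyond ℕ.≤-refl n)
  where open Counting (suc (suc j ℕ.* 2))

2∤k⇒k≡1+q*2 : ∀ k → ¬ 2 ∣ k → ∃[ q ] k ≡ suc (q ℕ.* 2)
2∤k⇒k≡1+q*2 zero          ∤k = contradiction (divides 0 refl) ∤k
2∤k⇒k≡1+q*2 (suc zero)    _  = 0 , refl
2∤k⇒k≡1+q*2 (suc (suc k)) ∤k with 2∤k⇒k≡1+q*2 k (∤k ∘ ∣m∣n⇒∣m+n ∣-refl)
... | q , refl = suc q , refl

A⊛denomEven≡one : ∀ k → 2 ≤ k → 2 ∣ k → ∀ n → (A k ⊛ denomEven k) n ≡ one n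
A⊛denomEven≡one _ () (divides zero refl)
A⊛denomEven≡one _ _  (divides (suc j) refl) =
  subst (λ m → ∀ n → (A k ⊛ evenDenominator m) n ≡ one n) (sym half) (A⊛evenDenominator≡one j)
  where
  k : ℕ
  k = suc j ℕ.* 2
  half : (k ℕ.+ 2) ℕ./ 2 ≡ suc (suc j)
  half = trans (cong (ℕ._/ 2) (ℕ.+-comm k 2)) (m*n/n≡m (suc (suc j)) 2)

A⊛denomOdd≡one : ∀ k → 2 ≤ k → ¬ 2 ∣ k → ∀ n → (A k ⊛ denomOdd k) n ≡ one n
A⊛denomOdd≡one k 2≤k ∤k with 2∤k⇒k≡1+q*2 k ∤k
... | zero  , refl = contradiction 2≤k λ { (s≤s ()) }
... | suc j , refl =
  subst (λ m → ∀ n → (A k ⊛ oddDenominator m) n ≡ one n) (sym half) (A⊛oddDenominator≡one j)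
  where
  half : (k ℕ.+ 1) ℕ./ 2 ≡ suc (suc j)
  half = trans (cong (ℕ._/ 2) (ℕ.+-comm k 1)) (m*n/n≡m (suc (suc j)) 2)

theorem5 : (k : ℕ) → 2 ≤ k →
    ((2 ∣ k) → (n : ℕ) → (A k ⊛ denomEven k) n ≡ one n) ×
    (¬ (2 ∣ k) → (n : ℕ) → (A k ⊛ denomOdd k) n ≡ one n)
theorem5 k 2≤k = A⊛denomEven≡one k 2≤k , A⊛denomOdd≡one k 2≤k
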